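{- Let $k$ and $m$ be positive integers with $k$ odd. If a finite simple graph $G$ is $(2mk:mk)$-choosable, then $G$ is also $2m$-choosable (i.e., $(2m:1)$-choosable).
   Context: A graph $G=(V,E)$ is $(a:b)$-choosable if for every family of sets $\{S(v):v\in V\}$ with $|S(v)|=a$ for all $v$, there exist subsets $C(v)\subseteq S(v)$ with $|C(v)|=b$ for every $v$ and $C(u)\cap C(v)=\emptyset$ whenever $u,v$ are adjacent. $k$-choosable means $(k:1)$-choosable. -}

module Defs where

open import Data.Nat using (ℕ)
open import Data.Fin using (Fin)
open import Data.Product using (Σ; _×_)
open import Data.List using (List; length)
open import Data.List.Membership.Propositional using (_∈_)
open import Data.List.Relation.Unary.Unique.Propositional using (Unique)
open import Data.List.Relation.Binary.Subset.Propositional using (_⊆_)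
open import Relation.Binary.PropositionalEquality using (_≡_)
open import Relation.Nullary using (¬_)

record SimpleGraph (n : ℕ) : Set₁ where
  field
    Adj   : Fin n → Fin n → Set
    irrefl : ∀ v → ¬ Adj v v
    sym    : ∀ {u v} → Adj u v → Adj v u
open SimpleGraph public

IsSetOfSize : ℕ → List ℕ → Set
IsSetOfSize a S = Unique S × length S ≡ a

Disjoint : List ℕ → List ℕ → Set
Disjoint A B = ∀ {x} → x ∈ A → ¬ (x ∈ B)

Choosable : {n : ℕ} → SimpleGraph n → ℕ → ℕ → Set
Choosable {n} G a b =
  (S : Fin n → List ℕ) → (∀ v → IsSetOfSize a (S v)) →
  Σ (Fin n → List ℕ) λ C →
    (∀ v → IsSetOfSize b (C v) × C v ⊆ S v) ×
    (∀ u v → Adj G u v → Disjoint (C u) (C v))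

KChoosable : {n : ℕ} → SimpleGraph n → ℕ → Set
KChoosable G k = Choosable G k 1

-- Replace every colour c by a block of k fresh colours.  A (2mk:mk)-colouring
-- of the blown-up lists gives each vertex mk colours spread over its 2m blocks,
-- so by pigeonhole some block of S(v) receives more than (k-1)/2 of them.  Two
-- adjacent vertices cannot both do so in the same block, since they receive
-- disjoint sets and a block has only k elements, k being odd.  Colouring each
-- vertex by such a majority block is therefore proper.
module Submission where

open import Defs hiding (sym)
open import Data.Nat using (ℕ; _*_; _+_; NonZero; >-nonZero⁻¹; suc; _≤_; _<_; z≤n; s≤s; _<?_; _≟_)
open import Data.Nat.Properties
open import Data.Nat.DivMod using (_/_; m≡m%n+[m/n]*n; m%n<n; m*n/n≡m; +-distrib-/-∣ʳ; m<n⇒m/n≡0)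
open import Data.Nat.Divisibility using (divides-refl)
open import Data.Nat.Solver using (module +-*-Solver)
open import Data.Product using (∃; _×_; _,_; proj₁; proj₂)
open import Data.Empty using (⊥; ⊥-elim)
open import Data.Fin using (Fin)
open import Data.List using (List; []; _∷_; [_]; _++_; map; upTo; length; filter; concatMap)
import Data.List.Relation.Binary.Disjoint.Propositional as List
open import Data.List.Properties using (length-map; length-++; length-upTo; length-removeAt′; filter-++)
open import Data.List.Relation.Unary.Any as Any using (here; there; any?; index)
import Data.List.Relation.Unary.All as All
import Data.List.Relation.Unary.All.Properties as All
import Data.List.Relation.Unary.AllPairs as AllPairs
import Data.List.Relation.Unary.AllPairs.Properties as AllPairs
open import Data.List.Membership.Propositional using (_∈_; _─_; find)
open import Data.List.Membership.Propositional.Properties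
  using (∈-map⁺; ∈-map⁻; ∈-upTo⁺; ∈-upTo⁻; ∈-filter⁺; ∈-filter⁻; ∈-concatMap⁺; ∈-concatMap⁻)
open import Data.List.Relation.Unary.Unique.Propositional using (Unique)
import Data.List.Relation.Unary.Unique.Propositional.Properties as Unique
open import Data.List.Relation.Binary.Subset.Propositional using (_⊆_)
open import Relation.Binary.Definitions using (DecidableEquality)
open import Relation.Binary.PropositionalEquality using (_≡_; _≢_; refl; sym; trans; cong; cong₂; subst; module ≡-Reasoning)
open import Relation.Nullary using (yes; no)
open import Function using (_∘_)

module _ {A : Set} where

  ∈-─ : ∀ {x y : A} {ys} (x∈ys : x ∈ ys) → y ∈ ys → y ≢ x → y ∈ ys ─ x∈ys
  ∈-─ (here refl) (here refl) y≢x = ⊥-elim (y≢x refl)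
  ∈-─ (here _)    (there y∈ys) _   = y∈ys
  ∈-─ (there _)   (here refl)  _   = here refl
  ∈-─ (there x∈ys) (there y∈ys) y≢x = there (∈-─ x∈ys y∈ys y≢x)

  Unique-⊆⇒length≤ : ∀ {xs ys : List A} → Unique xs → xs ⊆ ys → length xs ≤ length ys
  Unique-⊆⇒length≤ {[]}     _            _     = z≤n
  Unique-⊆⇒length≤ {x ∷ xs} {ys} (x∉xs AllPairs.∷ u) xs⊆ys = begin
    suc (length xs)          ≤⟨ s≤s (Unique-⊆⇒length≤ u xs⊆ys─x) ⟩
    suc (length (ys ─ x∈ys)) ≡⟨ sym (length-removeAt′ ys (index x∈ys)) ⟩
    length ys                ∎
    where
    open ≤-Reasoning
    x∈ys : x ∈ ys
    x∈ys = xs⊆ys (here refl)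
    xs⊆ys─x : xs ⊆ ys ─ x∈ys
    xs⊆ys─x y∈xs = ∈-─ x∈ys (xs⊆ys (there y∈xs)) (λ y≡x → All.lookup x∉xs y∈xs (sym y≡x))

  length-concatMap≤ : ∀ {B : Set} (g : B → List A) {L j} →
                      (∀ {b} → b ∈ L → length (g b) ≤ j) → length (concatMap g L) ≤ length L * j
  length-concatMap≤ g {[]}    _ = z≤n
  length-concatMap≤ g {b ∷ L} {j} bounded = begin
    length (g b ++ concatMap g L)          ≡⟨ length-++ (g b) ⟩
    length (g b) + length (concatMap g L)  ≤⟨ +-mono-≤ (bounded (here refl))
                                                        (length-concatMap≤ g (bounded ∘ there)) ⟩
    j + length L * j                       ∎
    where open ≤-Reasoning

module Fibres {A B : Set} (_≟ᴮ_ : DecidableEquality B) (f : A → B) where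

  fibre : B → List A → List A
  fibre b = filter (λ x → f x ≟ᴮ b)

  ⊆-concatMap-fibre : ∀ {C L} → (∀ {x} → x ∈ C → f x ∈ L) → C ⊆ concatMap (λ b → fibre b C) L
  ⊆-concatMap-fibre {C} maps x∈C =
    ∈-concatMap⁺ (λ b → fibre b C) (Any.map (∈-filter⁺ (λ x → f x ≟ᴮ _) x∈C) (maps x∈C))

  pigeonhole : ∀ {C L} j → Unique C → (∀ {x} → x ∈ C → f x ∈ L) → length L * j < length C →
               ∃ λ b → b ∈ L × j < length (fibre b C)
  pigeonhole {C} {L} j uniq maps overfull with any? (λ b → j <? length (fibre b C)) L
  ... | yes crowded = find crowded
  ... | no  ¬crowded = ⊥-elim (<⇒≱ overfull (begin
    length C                               ≤⟨ Unique-⊆⇒length≤ uniq (⊆-concatMap-fibre maps) ⟩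
    length (concatMap (λ b → fibre b C) L) ≤⟨ length-concatMap≤ (λ b → fibre b C) fibre≤j ⟩
    length L * j                           ∎))
    where
    open ≤-Reasoning
    fibre≤j : ∀ {b} → b ∈ L → length (fibre b C) ≤ j
    fibre≤j b∈L = ≮⇒≥ (All.lookup (All.¬Any⇒All¬ L ¬crowded) b∈L)

module Blocks (k : ℕ) .{{_ : NonZero k}} where

  open Fibres _≟_ (_/ k) public

  block : ℕ → List ℕ
  block c = map (_+ c * k) (upTo k)

  blowup : List ℕ → List ℕ
  blowup = concatMap block

  length-block : ∀ c → length (block c) ≡ k
  length-block c = trans (length-map (_+ c * k) (upTo k)) (length-upTo k)

  block-unique : ∀ c → Unique (block c)
  block-unique c = Unique.map⁺ (+-cancelʳ-≡ (c * k) _ _) (Unique.upTo⁺ k)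

  ∈-block⇒/ : ∀ {c x} → x ∈ block c → x / k ≡ c
  ∈-block⇒/ {c} x∈block with i , i∈upTo , refl ← ∈-map⁻ (_+ c * k) x∈block = begin
    (i + c * k) / k    ≡⟨ +-distrib-/-∣ʳ i (divides-refl c) ⟩
    i / k + c * k / k  ≡⟨ cong₂ _+_ (m<n⇒m/n≡0 (∈-upTo⁻ i∈upTo)) (m*n/n≡m c k) ⟩
    c                  ∎
    where open ≡-Reasoning

  ∈-block[/] : ∀ x → x ∈ block (x / k)
  ∈-block[/] x = subst (_∈ block (x / k)) (sym (m≡m%n+[m/n]*n x k))
                   (∈-map⁺ (_+ x / k * k) (∈-upTo⁺ (m%n<n x k)))

  fibre⊆block : ∀ c C → fibre c C ⊆ block c
  fibre⊆block c C {x} x∈fibre =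
    subst (λ b → x ∈ block b) (proj₂ (∈-filter⁻ (λ y → y / k ≟ c) {xs = C} x∈fibre)) (∈-block[/] x)

  length-fibre≤ : ∀ c {C} → Unique C → length (fibre c C) ≤ k
  length-fibre≤ c {C} uniq = begin
    length (fibre c C)  ≤⟨ Unique-⊆⇒length≤ (Unique.filter⁺ _ uniq) (fibre⊆block c C) ⟩
    length (block c)    ≡⟨ length-block c ⟩
    k                   ∎
    where open ≤-Reasoning

  blocks-disjoint : ∀ {c c′} → c ≢ c′ → List.Disjoint (block c) (block c′)
  blocks-disjoint c≢c′ (x∈c , x∈c′) = c≢c′ (trans (sym (∈-block⇒/ x∈c)) (∈-block⇒/ x∈c′))

  blowup-unique : ∀ {L} → Unique L → Unique (blowup L)
  blowup-unique {L} uniq = Unique.concat⁺ (All.map⁺ (All.universal block-unique L))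
                                          (AllPairs.map⁺ (AllPairs.map blocks-disjoint uniq))

  length-blowup : ∀ L → length (blowup L) ≡ length L * k
  length-blowup []      = refl
  length-blowup (c ∷ L) = trans (length-++ (block c)) (cong₂ _+_ (length-block c) (length-blowup L))

  blowup-isSetOfSize : ∀ {a L} → IsSetOfSize a L → IsSetOfSize (a * k) (blowup L)
  blowup-isSetOfSize {L = L} (uniq , refl) = blowup-unique uniq , length-blowup L

  ∈-blowup⇒/ : ∀ {L x} → x ∈ blowup L → x / k ∈ L
  ∈-blowup⇒/ {L} {x} x∈blowup =
    Any.map (λ {c} (x∈block : x ∈ block c) → ∈-block⇒/ x∈block) (∈-concatMap⁻ block x∈blowup)

  majority-block : ∀ {m j L C} → .{{NonZero m}} → k ≡ 2 * j + 1 →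
                   length L ≡ 2 * m → IsSetOfSize (m * k) C → C ⊆ blowup L →
                   ∃ λ c → c ∈ L × j < length (fibre c C)
  majority-block {m} {j} {L} {C} k≡2j+1 |L|≡2m (uniq , |C|≡mk) C⊆blowup =
    pigeonhole j uniq (∈-blowup⇒/ ∘ C⊆blowup) (begin-strict
      length L * j     ≡⟨ cong (_* j) |L|≡2m ⟩
      2 * m * j        <⟨ m<m+n (2 * m * j) (>-nonZero⁻¹ m) ⟩
      2 * m * j + m    ≡⟨ solve 2 (λ m j → con 2 :* m :* j :+ m := m :* (con 2 :* j :+ con 1)) refl m j ⟩
      m * (2 * j + 1)  ≡⟨ cong (m *_) k≡2j+1 ⟨
      m * k            ≡⟨ |C|≡mk ⟨
      length C         ∎)
    where
    open ≤-Reasoning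
    open +-*-Solver

  no-shared-majority : ∀ {j c C₁ C₂} → k ≡ 2 * j + 1 →
                       Unique C₁ → Unique C₂ → Disjoint C₁ C₂ →
                       j < length (fibre c C₁) → j < length (fibre c C₂) → ⊥
  no-shared-majority {j} {c} {C₁} {C₂} k≡2j+1 uniq₁ uniq₂ C₁∩C₂=∅ j<|F₁| j<|F₂| =
    <⇒≱ (begin-strict
      k                                         ≡⟨ k≡2j+1 ⟩
      2 * j + 1                                 ≡⟨ solve 1 (λ j → con 2 :* j :+ con 1 := j :+ (con 1 :+ j)) refl j ⟩
      j + suc j                                 <⟨ +-mono-<-≤ j<|F₁| j<|F₂| ⟩
      length (fibre c C₁) + length (fibre c C₂) ≡⟨ length-++ (fibre c C₁) ⟨
      length (fibre c C₁ ++ fibre c C₂)         ≡⟨ cong length (filter-++ (λ x → x / k ≟ c) C₁ C₂) ⟨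
      length (fibre c (C₁ ++ C₂))               ∎)
    (length-fibre≤ c (Unique.++⁺ uniq₁ uniq₂ λ (x∈C₁ , x∈C₂) → C₁∩C₂=∅ x∈C₁ x∈C₂))
    where
    open ≤-Reasoning
    open +-*-Solver

theorem5 : (k m : ℕ) → NonZero k → NonZero m → ∃ (λ j → k ≡ 2 * j + 1) →
    (n : ℕ) (G : SimpleGraph n) →
    Choosable G (2 * m * k) (m * k) → KChoosable G (2 * m)
theorem5 k m nzk nzm (j , k≡2j+1) n G choosable S S-sizes
  with choosable (Blocks.blowup k {{nzk}} ∘ S) (λ v → Blocks.blowup-isSetOfSize k {{nzk}} (S-sizes v))
... | C , C-fits , C-proper = colour , colour-fits , colour-proper
  where
  open Blocks k {{nzk}}

  majority : ∀ v → ∃ λ c → c ∈ S v × j < length (fibre c (C v))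
  majority v = majority-block {{nzm}} k≡2j+1 (proj₂ (S-sizes v)) (proj₁ (C-fits v)) (proj₂ (C-fits v))

  colour : Fin n → List ℕ
  colour v = [ proj₁ (majority v) ]

  colour-fits : ∀ v → IsSetOfSize 1 (colour v) × colour v ⊆ S v
  colour-fits v = (All.[] AllPairs.∷ AllPairs.[] , refl) , λ { (here refl) → proj₁ (proj₂ (majority v)) }

  colour-proper : ∀ u v → Adj G u v → Disjoint (colour u) (colour v)
  colour-proper u v u~v (here refl) (here cᵤ≡cᵥ) =
    no-shared-majority k≡2j+1 (proj₁ (proj₁ (C-fits u))) (proj₁ (proj₁ (C-fits v))) (C-proper u v u~v)
      (subst (λ c → j < length (fibre c (C u))) cᵤ≡cᵥ (proj₂ (proj₂ (majority u))))
      (proj₂ (proj₂ (majority v)))
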